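{- Let $\mathbf{g}_1,\dots,\mathbf{g}_n\in\mathbb{Z}[t]^m$ all have the same degree $d$ and form an asymptotically LLL-reduced basis (with factor $\delta$, $1/4<\delta<1$) of the lattice they span, with Gram–Schmidt coefficients $\rho_{i,\ell}$ over $\mathbb{Q}(t)$. Suppose that for some $1\le j<k\le n$ we have $\lim_{t\to\infty}|\rho_{k,j}(t)|=1/2$ but $|\rho_{k,j}(t)|>1/2$ for all sufficiently large $t$. Then for a suitable choice of sign, replacing $\mathbf{g}_k$ by $\mathbf{g}_k'=\mathbf{g}_k\pm\mathbf{g}_j$ yields a list $\mathbf{g}_1,\dots,\mathbf{g}_k',\dots,\mathbf{g}_n$ whose Gram–Schmidt coefficients $\rho'_{i,\ell}$ satisfy: (1) $\rho'_{k,i}=\rho_{k,i}$ whenever $j<i<k$, and $\rho'_{\ell,i}=\rho_{\ell,i}$ whenever $\ell\ne k$; (2) $|\rho'_{k,j}(t)|<1/2$ for all sufficiently large $t$; (3) the new list still satisfies the asymptotic Lovász condition with the same factor $\delta$.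
   Context: For $\mathbf{g}\in\mathbb{Z}[t]^m$, $\deg\mathbf{g}$ is the maximum degree of its coordinates. Gram–Schmidt over $\mathbb{Q}(t)$ without normalization: $\mathbf{g}_1^*=\mathbf{g}_1$, $\mathbf{g}_i^*=\mathbf{g}_i-\sum_{\ell<i}\rho_{i,\ell}\mathbf{g}_\ell^*$, $\rho_{i,\ell}=\langle\mathbf{g}_i,\mathbf{g}_\ell^*\rangle/\langle\mathbf{g}_\ell^*,\mathbf{g}_\ell^*\rangle$. Asymptotic Lovász condition with factor $\delta$: $\lim_{t\to\infty}\big(\|\mathbf{g}_i^*(t)\|^2/\|\mathbf{g}_{i-1}^*(t)\|^2+\rho_{i,i-1}(t)^2\big)\ge\delta$ for $2\le i\le n$ (limit may be $+\infty$). Asymptotically LLL-reduced: this condition together with $\lim_{t\to\infty}|\rho_{i,\ell}(t)|\le1/2$ for all $\ell<i$.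
   Formalization: The factor δ is rational, and t ranges over the rationals in all limits and in every condition required for all sufficiently large t. -}

module Defs where

open import Data.Nat as ℕ using (ℕ; zero; suc)
open import Data.Integer as ℤ using (ℤ)
open import Data.Rational as ℚ using (ℚ; 0ℚ; 1ℚ; _+_; _*_; _-_; ∣_∣; _≤_; _<_; _÷_; ≢-nonZero)
open import Data.Rational.Properties using (_≟_)
open import Data.Fin as Fin using (Fin; toℕ; fromℕ<)
open import Data.List as List using (List; []; _∷_; _++_)
open import Data.Product using (Σ; ∃; ∃-syntax; _×_; _,_)
open import Data.Sum using (_⊎_)
open import Data.Bool using (Bool; true; false; if_then_else_)
open import Relation.Nullary using (¬_; yes; no)
open import Relation.Binary.PropositionalEquality using (_≡_; _≢_)

-- Polynomials in ℤ[t]: coefficient lists, constant coefficient first.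

Poly : Set
Poly = List ℤ

coeff : Poly → ℕ → ℤ
coeff []       _       = ℤ.0ℤ
coeff (c ∷ _)  zero    = c
coeff (_ ∷ cs) (suc k) = coeff cs k

IsZeroPoly : Poly → Set
IsZeroPoly p = ∀ k → coeff p k ≡ ℤ.0ℤ

polyAdd : Poly → Poly → Poly
polyAdd []       q        = q
polyAdd p        []       = p
polyAdd (a ∷ p)  (b ∷ q)  = (a ℤ.+ b) ∷ polyAdd p q

polyNeg : Poly → Poly
polyNeg = List.map (λ c → ℤ.- c)

polyScale : ℤ → Poly → Poly
polyScale c = List.map (c ℤ.*_)

polyMul : Poly → Poly → Poly
polyMul []      q = []
polyMul (a ∷ p) q = polyAdd (polyScale a q) (ℤ.0ℤ ∷ polyMul p q)

evalPoly : Poly → ℚ → ℚ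
evalPoly []       t = 0ℚ
evalPoly (c ∷ cs) t = (c ℚ./ 1) + t * evalPoly cs t

DegLE : Poly → ℕ → Set
DegLE p d = ∀ k → d ℕ.< k → coeff p k ≡ ℤ.0ℤ

PVec : ℕ → Set
PVec m = Fin m → Poly

VecDeg : ∀ {m} → PVec m → ℕ → Set
VecDeg {m} g d = (∀ r → DegLE (g r) d) × (∃[ r ] (coeff (g r) d ≢ ℤ.0ℤ))

vecAdd vecSub : ∀ {m} → PVec m → PVec m → PVec m
vecAdd g h r = polyAdd (g r) (h r)
vecSub g h r = polyAdd (g r) (polyNeg (h r))

polySumFin : ∀ {n} → (Fin n → Poly) → Poly
polySumFin {zero}  f = []
polySumFin {suc n} f = polyAdd (f Fin.zero) (polySumFin (λ i → f (Fin.suc i)))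

-- g_1,…,g_n are linearly independent over ℤ[t] (equivalently over ℚ(t)),
-- i.e. they form a basis of the ℤ[t]-lattice they span.
LinIndep : ∀ {m n} → (Fin n → PVec m) → Set
LinIndep {m} {n} g =
  (c : Fin n → Poly) →
  (∀ r → IsZeroPoly (polySumFin (λ i → polyMul (c i) (g i r)))) →
  ∀ i → IsZeroPoly (c i)

replaceAt : ∀ {m n} → (Fin n → PVec m) → Fin n → PVec m → (Fin n → PVec m)
replaceAt g k v i with i Fin.≟ k
... | yes _ = v
... | no  _ = g i

-- A rational function in ℚ(t) is represented by its value function ℚ → ℚ;
-- evaluating the Gram–Schmidt process over ℚ(t) at t agrees with running it
-- over ℚ on the evaluated vectors at every t where no denominator vanishes,
-- hence for all sufficiently large t.  Division by 0 is totalised to 0.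

QVec : ℕ → Set
QVec m = Fin m → ℚ

divℚ : ℚ → ℚ → ℚ
divℚ p q with q ≟ 0ℚ
... | yes _  = 0ℚ
... | no q≢0 = _÷_ p q {{≢-nonZero q≢0}}

dot : ∀ {m} → QVec m → QVec m → ℚ
dot {zero}  u v = 0ℚ
dot {suc m} u v = u Fin.zero * v Fin.zero + dot (λ i → u (Fin.suc i)) (λ i → v (Fin.suc i))

qvSub : ∀ {m} → QVec m → QVec m → QVec m
qvSub u v i = u i - v i

qvScale : ∀ {m} → ℚ → QVec m → QVec m
qvScale c v i = c * v i

reduce : ∀ {m} → QVec m → List (QVec m) → QVec m
reduce v []       = v
reduce v (u ∷ us) = reduce (qvSub v (qvScale (divℚ (dot v u) (dot u u)) u)) us

zeroQV : ∀ {m} → QVec m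
zeroQV _ = 0ℚ

ext : ∀ {m n} → (Fin n → QVec m) → ℕ → QVec m
ext {n = n} v k with k ℕ.<? n
... | yes k<n = v (fromℕ< k<n)
... | no  _   = zeroQV

starsUpTo : ∀ {m} → (ℕ → QVec m) → ℕ → List (QVec m)
starsUpTo v zero    = []
starsUpTo v (suc k) = starsUpTo v k ++ (reduce (v k) (starsUpTo v k) ∷ [])

evalVec : ∀ {m} → PVec m → ℚ → QVec m
evalVec g t r = evalPoly (g r) t

gsStar : ∀ {m n} → (Fin n → PVec m) → Fin n → ℚ → QVec m
gsStar g i t = reduce (ext (λ j → evalVec (g j) t) (toℕ i))
                      (starsUpTo (ext (λ j → evalVec (g j) t)) (toℕ i))

gsNormSq : ∀ {m n} → (Fin n → PVec m) → Fin n → ℚ → ℚ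
gsNormSq g i t = dot (gsStar g i t) (gsStar g i t)

-- ρ_{i,ℓ}(t) = ⟨g_i, g*_ℓ⟩ / ⟨g*_ℓ, g*_ℓ⟩   (meaningful for ℓ < i)
rho : ∀ {m n} → (Fin n → PVec m) → Fin n → Fin n → ℚ → ℚ
rho g i ℓ t = divℚ (dot (evalVec (g i) t) (gsStar g ℓ t)) (gsNormSq g ℓ t)

Eventually : (ℚ → Set) → Set
Eventually P = ∃[ N ] (∀ t → N < t → P t)

-- lim_{t→∞} f(t) = L  (finite limit; limits of elements of ℚ(t) are rational or ±∞)
HasLimit : (ℚ → ℚ) → ℚ → Set
HasLimit f L = ∀ ε → 0ℚ < ε → Eventually (λ t → ∣ f t - L ∣ < ε)

TendsToInfinity : (ℚ → ℚ) → Set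
TendsToInfinity f = ∀ M → Eventually (λ t → M < f t)

LimitGE : (ℚ → ℚ) → ℚ → Set
LimitGE f δ = (∃[ L ] (HasLimit f L × δ ≤ L)) ⊎ TendsToInfinity f

LimitLE : (ℚ → ℚ) → ℚ → Set
LimitLE f c = ∃[ L ] (HasLimit f L × L ≤ c)

-- equality of rational functions (agree at all sufficiently large t)
EqRF : (ℚ → ℚ) → (ℚ → ℚ) → Set
EqRF f h = Eventually (λ t → f t ≡ h t)

sq : ℚ → ℚ
sq x = x * x

-- asymptotic Lovász condition with factor δ, for 2 ≤ i ≤ n  (a = i-1, b = i)
AsymLovasz : ∀ {m n} → ℚ → (Fin n → PVec m) → Set
AsymLovasz {n = n} δ g =
  (a b : Fin n) → toℕ b ≡ suc (toℕ a) →
  LimitGE (λ t → divℚ (gsNormSq g b t) (gsNormSq g a t) + sq (rho g b a t)) δ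

AsymSizeReduced : ∀ {m n} → (Fin n → PVec m) → Set
AsymSizeReduced {n = n} g =
  (i ℓ : Fin n) → ℓ Fin.< i → LimitLE (λ t → ∣ rho g i ℓ t ∣) ℚ.½

AsymLLLReduced : ∀ {m n} → ℚ → (Fin n → PVec m) → Set
AsymLLLReduced δ g = AsymLovasz δ g × AsymSizeReduced g

-- Replacing g k by g k + c · g j with j < k is a shear: every Gram–Schmidt vector g*ᵢ is unchanged, so
-- the only coefficients that move are ρ k i ↦ ρ k i + c · ρ j i. As ρ j i = 0 for i > j and ρ j j = 1,
-- only ρ k j changes, to ρ k j + c. Being a rational function of t, ρ k j has eventually constant
-- sign, and c = ∓1 against that sign gives ∣ρ′ k j∣ = 1 - ∣ρ k j∣ < 1/2 for large t. The Lovász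
-- quantity at (j, k) changes by (ρ + c)² - ρ² = 1 - 2∣ρ k j∣ → 0, so its limit is unchanged, and the
-- other Lovász quantities do not change at all.

module Submission where

open import Defs
open import Data.Nat using (ℕ)
open import Data.Integer using (+_)
open import Data.Rational using (ℚ; _<_; _/_; ½; ∣_∣)
open import Data.Fin using (Fin)
open import Data.Bool using (Bool; if_then_else_)
open import Data.Product using (∃-syntax; _×_)
open import Relation.Binary.PropositionalEquality using (_≢_)

open import Data.Bool using (true; false)
open import Data.Empty using (⊥-elim)
open import Data.Fin as Fin using (toℕ; fromℕ<)
import Data.Fin.Properties as FinP
import Data.Integer as ℤ
import Data.Integer.Tactic.RingSolver as ℤ-Solver
open import Data.List as List using (List; []; _∷_; _++_; [_])
import Data.List.Properties as ListP
open import Data.List.Relation.Binary.Pointwise as Pointwise using (Pointwise; []; _∷_)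
open import Data.List.Relation.Unary.All as All using (All; []; _∷_)
import Data.List.Relation.Unary.All.Properties as AllP
open import Data.List.Relation.Unary.AllPairs as AllPairs using (AllPairs; []; _∷_)
import Data.List.Relation.Unary.AllPairs.Properties as AllPairsP
open import Data.Nat as ℕ using (zero; suc)
import Data.Nat.Properties as ℕP
open import Data.Product using (_,_; proj₁; proj₂)
open import Data.Rational
  using (0ℚ; 1ℚ; _+_; _*_; _-_; -_; 1/_; _≤_; _⊔_; toℚᵘ; ≢-nonZero; positive; nonNegative; nonPositive)
open import Data.Rational.Properties as ℚP using (_≟_)
import Data.Rational.Unnormalised as ℚᵘ
import Data.Rational.Unnormalised.Properties as ℚᵘP
open import Data.Sum using (_⊎_; inj₁; inj₂; [_,_]′)
open import Function using (_∘_)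
open import Relation.Binary using (tri<; tri≈; tri>)
open import Relation.Binary.PropositionalEquality hiding ([_])
open import Relation.Nullary using (Dec; yes; no)
open import Relation.Nullary.Decidable using (dec⇒maybe)
open import Tactic.RingSolver using (solve-∀)
import Tactic.RingSolver.Core.AlmostCommutativeRing as ACR

ℚ-ring : ACR.AlmostCommutativeRing _ _
ℚ-ring = ACR.fromCommutativeRing ℚP.+-*-commutativeRing (λ x → dec⇒maybe (0ℚ ≟ x))

-- Rational arithmetic

divℚ-by-0 : ∀ p → divℚ p 0ℚ ≡ 0ℚ
divℚ-by-0 p with 0ℚ ≟ 0ℚ
... | yes _ = refl
... | no 0≢0 = ⊥-elim (0≢0 refl)

divℚ-0 : ∀ q → divℚ 0ℚ q ≡ 0ℚ
divℚ-0 q with q ≟ 0ℚ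
... | yes _ = refl
... | no q≢0 = ℚP.*-zeroˡ (1/_ q {{≢-nonZero q≢0}})

divℚ-*-cancel : ∀ p q → q ≢ 0ℚ → divℚ p q * q ≡ p
divℚ-*-cancel p q q≢0 with q ≟ 0ℚ
... | yes q≡0 = ⊥-elim (q≢0 q≡0)
... | no q≢0 = begin
  p * 1/q * q   ≡⟨ ℚP.*-assoc p 1/q q ⟩
  p * (1/q * q) ≡⟨ cong (p *_) (ℚP.*-inverseˡ q {{≢-nonZero q≢0}}) ⟩
  p * 1ℚ        ≡⟨ ℚP.*-identityʳ p ⟩
  p             ∎
  where
  open ≡-Reasoning
  1/q = 1/_ q {{≢-nonZero q≢0}}

*-divℚ-cancel : ∀ p q → q ≢ 0ℚ → divℚ (p * q) q ≡ p
*-divℚ-cancel p q q≢0 with q ≟ 0ℚ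
... | yes q≡0 = ⊥-elim (q≢0 q≡0)
... | no q≢0 = begin
  p * q * 1/q   ≡⟨ ℚP.*-assoc p q 1/q ⟩
  p * (q * 1/q) ≡⟨ cong (p *_) (ℚP.*-inverseʳ q {{≢-nonZero q≢0}}) ⟩
  p * 1ℚ        ≡⟨ ℚP.*-identityʳ p ⟩
  p             ∎
  where
  open ≡-Reasoning
  1/q = 1/_ q {{≢-nonZero q≢0}}

divℚ-self : ∀ q → q ≢ 0ℚ → divℚ q q ≡ 1ℚ
divℚ-self q q≢0 with q ≟ 0ℚ
... | yes q≡0 = ⊥-elim (q≢0 q≡0)
... | no q≢0 = ℚP.*-inverseʳ q {{≢-nonZero q≢0}}

divℚ-axpy : ∀ p c q r → divℚ (p + c * q) r ≡ divℚ p r + c * divℚ q r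
divℚ-axpy p c q r with r ≟ 0ℚ
... | yes _ = absorb c
  where
  absorb : ∀ c → 0ℚ ≡ 0ℚ + c * 0ℚ
  absorb = solve-∀ ℚ-ring
... | no r≢0 = distrib p c q (1/_ r {{≢-nonZero r≢0}})
  where
  distrib : ∀ p c q s → (p + c * q) * s ≡ p * s + c * (q * s)
  distrib = solve-∀ ℚ-ring

*-cancelʳ-≡0 : ∀ p q → q ≢ 0ℚ → p * q ≡ 0ℚ → p ≡ 0ℚ
*-cancelʳ-≡0 p q q≢0 pq≡0 = begin
  p              ≡⟨ *-divℚ-cancel p q q≢0 ⟨
  divℚ (p * q) q ≡⟨ cong (λ x → divℚ x q) pq≡0 ⟩
  divℚ 0ℚ q      ≡⟨ divℚ-0 q ⟩
  0ℚ             ∎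
  where open ≡-Reasoning

sq-nonneg : ∀ x → 0ℚ ≤ x * x
sq-nonneg x with ℚP.≤-total 0ℚ x
... | inj₁ 0≤x = ℚP.nonNegative⁻¹ _ {{ℚP.nonNeg*nonNeg⇒nonNeg x {{nonNegative 0≤x}} x {{nonNegative 0≤x}}}}
... | inj₂ x≤0 = ℚP.nonNegative⁻¹ _ {{ℚP.nonPos*nonPos⇒nonPos x {{nonPositive x≤0}} x {{nonPositive x≤0}}}}

sq≡0⇒≡0 : ∀ x → x * x ≡ 0ℚ → x ≡ 0ℚ
sq≡0⇒≡0 x xx≡0 with x ≟ 0ℚ
... | yes x≡0 = x≡0
... | no x≢0 = *-cancelʳ-≡0 x x x≢0 xx≡0

p≤∣p∣ : ∀ p → p ≤ ∣ p ∣
p≤∣p∣ p with ℚP.≤-total 0ℚ p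
... | inj₁ 0≤p = ℚP.≤-reflexive (sym (ℚP.0≤p⇒∣p∣≡p 0≤p))
... | inj₂ p≤0 = ℚP.≤-trans p≤0 (ℚP.0≤∣p∣ p)

neg-involutive : ∀ p → - (- p) ≡ p
neg-involutive = solve-∀ ℚ-ring

-∣p∣≤p : ∀ p → - ∣ p ∣ ≤ p
-∣p∣≤p p = subst (- ∣ p ∣ ≤_) (neg-involutive p)
  (ℚP.neg-antimono-≤ (subst (- p ≤_) (ℚP.∣-p∣≡∣p∣ p) (p≤∣p∣ (- p))))

∣p∣<q⇒-q<p<q : ∀ {p q} → ∣ p ∣ < q → - q < p × p < q
∣p∣<q⇒-q<p<q {p} {q} ∣p∣<q =
  ℚP.<-≤-trans (ℚP.neg-antimono-< ∣p∣<q) (-∣p∣≤p p) , ℚP.≤-<-trans (p≤∣p∣ p) ∣p∣<q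

-q<p<q⇒∣p∣<q : ∀ {p q} → - q < p → p < q → ∣ p ∣ < q
-q<p<q⇒∣p∣<q {p} {q} -q<p p<q with ℚP.∣p∣≡p∨∣p∣≡-p p
... | inj₁ ∣p∣≡p  = subst (_< q) (sym ∣p∣≡p) p<q
... | inj₂ ∣p∣≡-p = subst (_< q) (sym ∣p∣≡-p) (subst (- p <_) (neg-involutive q) (ℚP.neg-antimono-< -q<p))

*-mono-≤-nonneg : ∀ {a a′ b b′} → 0ℚ ≤ a → a ≤ a′ → 0ℚ ≤ b → b ≤ b′ → a * b ≤ a′ * b′
*-mono-≤-nonneg {a} {a′} {b} {b′} 0≤a a≤a′ 0≤b b≤b′ =
  ℚP.≤-trans (ℚP.*-monoˡ-≤-nonNeg a {{nonNegative 0≤a}} b≤b′)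
             (ℚP.*-monoʳ-≤-nonNeg b′ {{nonNegative (ℚP.≤-trans 0≤b b≤b′)}} a≤a′)

-- Gram–Schmidt over ℚ

infix 4 _≈ᵛ_ _⊥_

_≈ᵛ_ : ∀ {m} → QVec m → QVec m → Set
u ≈ᵛ w = ∀ r → u r ≡ w r

-- A record rather than an alias for dot u w ≡ 0ℚ, so that u and w can be inferred.
record _⊥_ {m} (u w : QVec m) : Set where
  constructor orthogonal
  field dot≡0 : dot u w ≡ 0ℚ
open _⊥_ public

axpy : ∀ {m} → QVec m → ℚ → QVec m → QVec m
axpy a c b r = a r + c * b r

dot-cong : ∀ {m} {u u′ w w′ : QVec m} → u ≈ᵛ u′ → w ≈ᵛ w′ → dot u w ≡ dot u′ w′
dot-cong {zero}  _   _   = refl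
dot-cong {suc m} u≈ w≈ =
  cong₂ _+_ (cong₂ _*_ (u≈ Fin.zero) (w≈ Fin.zero)) (dot-cong (u≈ ∘ Fin.suc) (w≈ ∘ Fin.suc))

dot-comm : ∀ {m} (u w : QVec m) → dot u w ≡ dot w u
dot-comm {zero}  u w = refl
dot-comm {suc m} u w = cong₂ _+_ (ℚP.*-comm (u Fin.zero) (w Fin.zero)) (dot-comm (u ∘ Fin.suc) (w ∘ Fin.suc))

⊥-sym : ∀ {m} {u w : QVec m} → u ⊥ w → w ⊥ u
⊥-sym {u = u} {w} (orthogonal uw≡0) = orthogonal (trans (dot-comm w u) uw≡0)

dot-axpyˡ : ∀ {m} (a : QVec m) c b w → dot (axpy a c b) w ≡ dot a w + c * dot b w
dot-axpyˡ {zero}  a c b w = absorb c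
  where
  absorb : ∀ c → 0ℚ ≡ 0ℚ + c * 0ℚ
  absorb = solve-∀ ℚ-ring
dot-axpyˡ {suc m} a c b w =
  trans (cong (λ x → (a Fin.zero + c * b Fin.zero) * w Fin.zero + x) (dot-axpyˡ (a ∘ Fin.suc) c (b ∘ Fin.suc) (w ∘ Fin.suc)))
        (regroup (a Fin.zero) (b Fin.zero) (w Fin.zero) c
                 (dot (a ∘ Fin.suc) (w ∘ Fin.suc)) (dot (b ∘ Fin.suc) (w ∘ Fin.suc)))
  where
  regroup : ∀ a b w c x y → (a + c * b) * w + (x + c * y) ≡ (a * w + x) + c * (b * w + y)
  regroup = solve-∀ ℚ-ring

dot-zeroˡ : ∀ {m} {u : QVec m} (w : QVec m) → u ≈ᵛ zeroQV → dot u w ≡ 0ℚ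
dot-zeroˡ {zero}  w _ = refl
dot-zeroˡ {suc m} w u≈0 =
  trans (cong₂ (λ x y → x * w Fin.zero + y) (u≈0 Fin.zero) (dot-zeroˡ (w ∘ Fin.suc) (u≈0 ∘ Fin.suc)))
        (vanish (w Fin.zero))
  where
  vanish : ∀ x → 0ℚ * x + 0ℚ ≡ 0ℚ
  vanish = solve-∀ ℚ-ring

dot-self-nonneg : ∀ {m} (u : QVec m) → 0ℚ ≤ dot u u
dot-self-nonneg {zero}  u = ℚP.≤-refl
dot-self-nonneg {suc m} u = ℚP.+-mono-≤ (sq-nonneg (u Fin.zero)) (dot-self-nonneg (u ∘ Fin.suc))

sq≤dot-self : ∀ {m} (u : QVec m) r → u r * u r ≤ dot u u
sq≤dot-self {suc m} u Fin.zero =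
  ℚP.≤-trans (ℚP.≤-reflexive (sym (ℚP.+-identityʳ _)))
             (ℚP.+-monoʳ-≤ (u Fin.zero * u Fin.zero) (dot-self-nonneg (u ∘ Fin.suc)))
sq≤dot-self {suc m} u (Fin.suc r) =
  ℚP.≤-trans (sq≤dot-self (u ∘ Fin.suc) r)
    (ℚP.≤-trans (ℚP.≤-reflexive (sym (ℚP.+-identityˡ _)))
                (ℚP.+-monoˡ-≤ (dot (u ∘ Fin.suc) (u ∘ Fin.suc)) (sq-nonneg (u Fin.zero))))

dot-self≡0⇒≈0 : ∀ {m} (u : QVec m) → dot u u ≡ 0ℚ → u ≈ᵛ zeroQV
dot-self≡0⇒≈0 u uu≡0 r = sq≡0⇒≡0 (u r)
  (ℚP.≤-antisym (ℚP.≤-trans (sq≤dot-self u r) (ℚP.≤-reflexive uu≡0)) (sq-nonneg (u r)))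

project : ∀ {m} → QVec m → QVec m → QVec m
project v u = qvSub v (qvScale (divℚ (dot v u) (dot u u)) u)

project-cong : ∀ {m} {v v′ u u′ : QVec m} → v ≈ᵛ v′ → u ≈ᵛ u′ → project v u ≈ᵛ project v′ u′
project-cong v≈ u≈ r =
  cong₂ _-_ (v≈ r) (cong₂ _*_ (cong₂ divℚ (dot-cong v≈ u≈) (dot-cong u≈ u≈)) (u≈ r))

dot-project : ∀ {m} (v u w : QVec m) → dot (project v u) w ≡ dot v w - divℚ (dot v u) (dot u u) * dot u w
dot-project v u w = begin
  dot (project v u) w         ≡⟨ dot-cong (λ r → sub-as-axpy (v r) d (u r)) (λ _ → refl) ⟩
  dot (axpy v (- d) u) w      ≡⟨ dot-axpyˡ v (- d) u w ⟩
  dot v w + - d * dot u w     ≡⟨ sub-as-axpy (dot v w) d (dot u w) ⟨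
  dot v w - d * dot u w       ∎
  where
  open ≡-Reasoning
  d = divℚ (dot v u) (dot u u)
  sub-as-axpy : ∀ x d y → x - d * y ≡ x + - d * y
  sub-as-axpy = solve-∀ ℚ-ring

project-⊥ : ∀ {m} (v u : QVec m) → project v u ⊥ u
project-⊥ v u = orthogonal (trans (dot-project v u u) (by-cases (dot u u ≟ 0ℚ)))
  where
  open ≡-Reasoning
  d = divℚ (dot v u) (dot u u)
  vanish : ∀ d → 0ℚ - d * 0ℚ ≡ 0ℚ
  vanish = solve-∀ ℚ-ring
  by-cases : Dec (dot u u ≡ 0ℚ) → dot v u - d * dot u u ≡ 0ℚ
  by-cases (yes uu≡0) = begin
    dot v u - d * dot u u ≡⟨ cong₂ (λ x y → x - d * y)
                                   (trans (dot-comm v u) (dot-zeroˡ v (dot-self≡0⇒≈0 u uu≡0))) uu≡0 ⟩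
    0ℚ - d * 0ℚ           ≡⟨ vanish d ⟩
    0ℚ                    ∎
  by-cases (no uu≢0) = begin
    dot v u - d * dot u u ≡⟨ cong (λ x → dot v u - x) (divℚ-*-cancel (dot v u) (dot u u) uu≢0) ⟩
    dot v u - dot v u     ≡⟨ ℚP.+-inverseʳ (dot v u) ⟩
    0ℚ                    ∎

project-preserves : ∀ {m} (v : QVec m) {u w} → u ⊥ w → dot (project v u) w ≡ dot v w
project-preserves v {u} {w} (orthogonal uw≡0) =
  trans (dot-project v u w)
        (trans (cong (λ y → dot v w - divℚ (dot v u) (dot u u) * y) uw≡0) (drop (dot v w) (divℚ (dot v u) (dot u u))))
  where
  drop : ∀ x d → x - d * 0ℚ ≡ x
  drop = solve-∀ ℚ-ring

project-self : ∀ {m} (u : QVec m) → project u u ≈ᵛ zeroQV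
project-self u r = by-cases (dot u u ≟ 0ℚ)
  where
  vanish : ∀ d → 0ℚ - d * 0ℚ ≡ 0ℚ
  vanish = solve-∀ ℚ-ring
  cancel : ∀ x → x - 1ℚ * x ≡ 0ℚ
  cancel = solve-∀ ℚ-ring
  by-cases : Dec (dot u u ≡ 0ℚ) → project u u r ≡ 0ℚ
  by-cases (yes uu≡0) =
    trans (cong (λ x → x - divℚ (dot u u) (dot u u) * x) (dot-self≡0⇒≈0 u uu≡0 r)) (vanish (divℚ (dot u u) (dot u u)))
  by-cases (no uu≢0) = trans (cong (λ d → u r - d * u r) (divℚ-self (dot u u) uu≢0)) (cancel (u r))

project-zero : ∀ {m} {v : QVec m} u → v ≈ᵛ zeroQV → project v u ≈ᵛ zeroQV
project-zero {v = v} u v≈0 r =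
  trans (cong₂ (λ x y → x - divℚ y (dot u u) * u r) (v≈0 r) (dot-zeroˡ u v≈0))
        (trans (cong (λ d → 0ℚ - d * u r) (divℚ-0 (dot u u))) (vanish (u r)))
  where
  vanish : ∀ x → 0ℚ - 0ℚ * x ≡ 0ℚ
  vanish = solve-∀ ℚ-ring

project-axpy : ∀ {m} (a : QVec m) c b u → project (axpy a c b) u ≈ᵛ axpy (project a u) c (project b u)
project-axpy a c b u r = begin
  (a r + c * b r) - divℚ (dot (axpy a c b) u) (dot u u) * u r
    ≡⟨ cong (λ x → (a r + c * b r) - divℚ x (dot u u) * u r) (dot-axpyˡ a c b u) ⟩
  (a r + c * b r) - divℚ (dot a u + c * dot b u) (dot u u) * u r
    ≡⟨ cong (λ x → (a r + c * b r) - x * u r) (divℚ-axpy (dot a u) c (dot b u) (dot u u)) ⟩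
  (a r + c * b r) - (α + c * β) * u r
    ≡⟨ regroup (a r) (b r) (u r) c α β ⟩
  (a r - α * u r) + c * (b r - β * u r) ∎
  where
  open ≡-Reasoning
  α = divℚ (dot a u) (dot u u)
  β = divℚ (dot b u) (dot u u)
  regroup : ∀ a b u c α β → (a + c * b) - (α + c * β) * u ≡ (a - α * u) + c * (b - β * u)
  regroup = solve-∀ ℚ-ring

reduce-cong : ∀ {m} {v v′ : QVec m} {us us′} → v ≈ᵛ v′ → Pointwise _≈ᵛ_ us us′ → reduce v us ≈ᵛ reduce v′ us′
reduce-cong v≈ []         = v≈
reduce-cong v≈ (u≈ ∷ us≈) = reduce-cong (project-cong v≈ u≈) us≈

reduce-++ : ∀ {m} (v : QVec m) us ws → reduce v (us ++ ws) ≡ reduce (reduce v us) ws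
reduce-++ v []       ws = refl
reduce-++ v (u ∷ us) ws = reduce-++ (project v u) us ws

reduce-axpy : ∀ {m} (a : QVec m) c b us → reduce (axpy a c b) us ≈ᵛ axpy (reduce a us) c (reduce b us)
reduce-axpy a c b []       r = refl
reduce-axpy a c b (u ∷ us) r =
  trans (reduce-cong {us = us} (project-axpy a c b u) (Pointwise.refl (λ _ → refl)) r)
        (reduce-axpy (project a u) c (project b u) us r)

reduce-zero : ∀ {m} {v : QVec m} us → v ≈ᵛ zeroQV → reduce v us ≈ᵛ zeroQV
reduce-zero []       v≈0 = v≈0
reduce-zero (u ∷ us) v≈0 = reduce-zero us (project-zero u v≈0)

reduce-preserves : ∀ {m} (v : QVec m) {us w} → All (_⊥ w) us → dot (reduce v us) w ≡ dot v w
reduce-preserves v []           = refl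
reduce-preserves v (u⊥w ∷ us⊥w) = trans (reduce-preserves _ us⊥w) (project-preserves v u⊥w)

reduce-⊥ : ∀ {m} (v : QVec m) {us} → AllPairs _⊥_ us → All (reduce v us ⊥_) us
reduce-⊥ v []                        = []
reduce-⊥ v {u ∷ us} (u⊥us ∷ us-orth) =
  orthogonal (trans (reduce-preserves (project v u) (All.map ⊥-sym u⊥us)) (dot≡0 (project-⊥ v u)))
  ∷ reduce-⊥ (project v u) us-orth

module GramSchmidt {m} (v : ℕ → QVec m) where

  stars : ℕ → List (QVec m)
  stars = starsUpTo v

  star : ℕ → QVec m
  star x = reduce (v x) (stars x)

  stars-orthogonal : ∀ x → AllPairs _⊥_ (stars x)

  star-⊥-stars : ∀ x → All (star x ⊥_) (stars x)
  star-⊥-stars x = reduce-⊥ (v x) (stars-orthogonal x)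

  stars-orthogonal zero    = []
  stars-orthogonal (suc x) = AllPairsP.++⁺ (stars-orthogonal x) (All.[] ∷ [])
    (All.map (λ u⊥star → ⊥-sym u⊥star ∷ []) (star-⊥-stars x))

  stars-prefix : ∀ {J I} → J ℕ.< I → ∃[ T ] stars I ≡ stars J ++ star J ∷ T
  stars-prefix {J} {suc I} J<1+I with ℕP.m<1+n⇒m<n∨m≡n J<1+I
  ... | inj₂ refl = [] , refl
  ... | inj₁ J<I with stars-prefix J<I
  ...   | T , eq = T ++ [ star I ] ,
                   trans (cong (_++ [ star I ]) eq) (ListP.++-assoc (stars J) (star J ∷ T) [ star I ])

  star-⊥-earlier : ∀ {J I} → J ℕ.< I → star I ⊥ star J × All (_⊥ star I) (stars J)
  star-⊥-earlier {J} {I} J<I with stars-prefix J<I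
  ... | T , eq with AllP.++⁻ (stars J) (subst (All (star I ⊥_)) eq (star-⊥-stars I))
  ...   | I⊥stars-J , I⊥J ∷ _ = I⊥J , All.map ⊥-sym I⊥stars-J

  v-⊥-later-star : ∀ {J I} → J ℕ.< I → v J ⊥ star I
  v-⊥-later-star {J} {I} J<I = orthogonal
    (trans (sym (reduce-preserves (v J) (proj₂ (star-⊥-earlier J<I)))) (dot≡0 (⊥-sym (proj₁ (star-⊥-earlier J<I)))))

  dot-v-star : ∀ J → dot (v J) (star J) ≡ dot (star J) (star J)
  dot-v-star J = sym (reduce-preserves (v J) (All.map ⊥-sym (star-⊥-stars J)))

  reduce-v-later-stars : ∀ {J I} → J ℕ.< I → reduce (v J) (stars I) ≈ᵛ zeroQV
  reduce-v-later-stars {J} {I} J<I r with stars-prefix J<I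
  ... | T , eq = begin
    reduce (v J) (stars I) r                    ≡⟨ cong (λ us → reduce (v J) us r) eq ⟩
    reduce (v J) (stars J ++ star J ∷ T) r      ≡⟨ cong (λ x → x r) (reduce-++ (v J) (stars J) (star J ∷ T)) ⟩
    reduce (project (star J) (star J)) T r      ≡⟨ reduce-zero T (project-self (star J)) r ⟩
    0ℚ                                          ∎
    where open ≡-Reasoning

module _ {m} {v v′ : ℕ → QVec m} {J K : ℕ} (J<K : J ℕ.< K) (c : ℚ)
         (v′≈v : ∀ x → x ≢ K → v′ x ≈ᵛ v x) (v′K≈ : v′ K ≈ᵛ axpy (v K) c (v J)) where

  private
    module G = GramSchmidt v
    module G′ = GramSchmidt v′

  stars-shear : ∀ x → Pointwise _≈ᵛ_ (G′.stars x) (G.stars x)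
  star-shear : ∀ x → G′.star x ≈ᵛ G.star x

  stars-shear zero    = []
  stars-shear (suc x) = Pointwise.++⁺ (stars-shear x) (star-shear x ∷ [])

  star-shear x with x ℕ.≟ K
  ... | no x≢K = reduce-cong (v′≈v x x≢K) (stars-shear x)
  ... | yes refl = λ r → begin
    G′.star x r                                           ≡⟨ reduce-cong v′K≈ (stars-shear x) r ⟩
    reduce (axpy (v x) c (v J)) (G.stars x) r             ≡⟨ reduce-axpy (v x) c (v J) (G.stars x) r ⟩
    G.star x r + c * reduce (v J) (G.stars x) r           ≡⟨ cong (λ y → G.star x r + c * y) (G.reduce-v-later-stars J<K r) ⟩
    G.star x r + c * 0ℚ                                   ≡⟨ drop (G.star x r) c ⟩
    G.star x r                                            ∎
    where
    open ≡-Reasoning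
    drop : ∀ x c → x + c * 0ℚ ≡ x
    drop = solve-∀ ℚ-ring

-- Rational functions of t

eventually-always : ∀ {P : ℚ → Set} → (∀ t → P t) → Eventually P
eventually-always P = 0ℚ , λ t _ → P t

eventually-map : ∀ {P Q : ℚ → Set} → (∀ t → P t → Q t) → Eventually P → Eventually Q
eventually-map P⇒Q (N , P) = N , λ t N<t → P⇒Q t (P t N<t)

eventually-zip : ∀ {P Q : ℚ → Set} → Eventually P → Eventually Q → Eventually (λ t → P t × Q t)
eventually-zip (N₁ , P) (N₂ , Q) = N₁ ⊔ N₂ , λ t N<t →
  P t (ℚP.≤-<-trans (ℚP.p≤p⊔q N₁ N₂) N<t) , Q t (ℚP.≤-<-trans (ℚP.p≤q⊔p N₁ N₂) N<t)

eventually-witness : ∀ {P : ℚ → Set} → Eventually P → ∃[ t ] P t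
eventually-witness (N , P) =
  N + 1ℚ , P (N + 1ℚ) (subst (_< N + 1ℚ) (ℚP.+-identityʳ N) (ℚP.+-monoʳ-< N (ℚP.positive⁻¹ 1ℚ)))

PolyQ : Set
PolyQ = List ℚ

evalQ : PolyQ → ℚ → ℚ
evalQ []       t = 0ℚ
evalQ (c ∷ cs) t = c + t * evalQ cs t

addQ : PolyQ → PolyQ → PolyQ
addQ []       q        = q
addQ (a ∷ p)  []       = a ∷ p
addQ (a ∷ p)  (b ∷ q)  = (a + b) ∷ addQ p q

scaleQ : ℚ → PolyQ → PolyQ
scaleQ a = List.map (a *_)

mulQ : PolyQ → PolyQ → PolyQ
mulQ []      q = []
mulQ (a ∷ p) q = addQ (scaleQ a q) (0ℚ ∷ mulQ p q)

evalQ-addQ : ∀ p q t → evalQ (addQ p q) t ≡ evalQ p t + evalQ q t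
evalQ-addQ []      q       t = sym (ℚP.+-identityˡ (evalQ q t))
evalQ-addQ (a ∷ p) []      t = sym (ℚP.+-identityʳ (evalQ (a ∷ p) t))
evalQ-addQ (a ∷ p) (b ∷ q) t =
  trans (cong (λ x → (a + b) + t * x) (evalQ-addQ p q t)) (regroup a b t (evalQ p t) (evalQ q t))
  where
  regroup : ∀ a b t x y → (a + b) + t * (x + y) ≡ (a + t * x) + (b + t * y)
  regroup = solve-∀ ℚ-ring

evalQ-scaleQ : ∀ a p t → evalQ (scaleQ a p) t ≡ a * evalQ p t
evalQ-scaleQ a []      t = sym (ℚP.*-zeroʳ a)
evalQ-scaleQ a (c ∷ p) t =
  trans (cong (λ x → a * c + t * x) (evalQ-scaleQ a p t)) (regroup a c t (evalQ p t))
  where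
  regroup : ∀ a c t x → a * c + t * (a * x) ≡ a * (c + t * x)
  regroup = solve-∀ ℚ-ring

evalQ-mulQ : ∀ p q t → evalQ (mulQ p q) t ≡ evalQ p t * evalQ q t
evalQ-mulQ []      q t = sym (ℚP.*-zeroˡ (evalQ q t))
evalQ-mulQ (a ∷ p) q t = begin
  evalQ (addQ (scaleQ a q) (0ℚ ∷ mulQ p q)) t     ≡⟨ evalQ-addQ (scaleQ a q) (0ℚ ∷ mulQ p q) t ⟩
  evalQ (scaleQ a q) t + (0ℚ + t * evalQ (mulQ p q) t)
    ≡⟨ cong₂ (λ x y → x + (0ℚ + t * y)) (evalQ-scaleQ a q t) (evalQ-mulQ p q t) ⟩
  a * evalQ q t + (0ℚ + t * (evalQ p t * evalQ q t))  ≡⟨ regroup a t (evalQ p t) (evalQ q t) ⟩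
  (a + t * evalQ p t) * evalQ q t                     ∎
  where
  open ≡-Reasoning
  regroup : ∀ a t x y → a * y + (0ℚ + t * (x * y)) ≡ (a + t * x) * y
  regroup = solve-∀ ℚ-ring

-- A uniform bound ε rather than mere positivity, so that c + t · f t inherits it.

EventuallyPositive : (ℚ → ℚ) → Set
EventuallyPositive f = ∃[ ε ] (0ℚ < ε × Eventually (λ t → ε ≤ f t))

EventuallyPositive-cong : ∀ {f h} → (∀ t → f t ≡ h t) → EventuallyPositive f → EventuallyPositive h
EventuallyPositive-cong f≡h (ε , 0<ε , ε≤f) = ε , 0<ε , eventually-map (λ t → subst (ε ≤_) (f≡h t)) ε≤f

EventuallyPositive⇒>0 : ∀ {f} → EventuallyPositive f → Eventually (λ t → 0ℚ < f t)
EventuallyPositive⇒>0 (ε , 0<ε , ε≤f) = eventually-map (λ t → ℚP.<-≤-trans 0<ε) ε≤f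

EventuallyPositive⇒≢0 : ∀ {f} → EventuallyPositive f → Eventually (λ t → f t ≢ 0ℚ)
EventuallyPositive⇒≢0 pos = eventually-map (λ t 0<f f≡0 → ℚP.<-irrefl (sym f≡0) 0<f) (EventuallyPositive⇒>0 pos)

EventuallyPositive-* : ∀ {f h} → EventuallyPositive f → EventuallyPositive h → EventuallyPositive (λ t → f t * h t)
EventuallyPositive-* (ε₁ , 0<ε₁ , ε₁≤f) (ε₂ , 0<ε₂ , ε₂≤h) =
  ε₁ * ε₂ ,
  ℚP.positive⁻¹ _ {{ℚP.pos*pos⇒pos ε₁ {{positive 0<ε₁}} ε₂ {{positive 0<ε₂}}}} ,
  eventually-map (λ t (ε₁≤f , ε₂≤h) → *-mono-≤-nonneg (ℚP.<⇒≤ 0<ε₁) ε₁≤f (ℚP.<⇒≤ 0<ε₂) ε₂≤h)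
                 (eventually-zip ε₁≤f ε₂≤h)

EventuallyPositive-horner : ∀ c {f} → EventuallyPositive f → EventuallyPositive (λ t → c + t * f t)
EventuallyPositive-horner c {f} (ε , 0<ε , N , ε≤f) = ε , 0<ε , N ⊔ T , λ t N⊔T<t →
  bound t (ℚP.≤-<-trans (ℚP.p≤p⊔q N T) N⊔T<t) (ℚP.≤-<-trans (ℚP.p≤q⊔p N T) N⊔T<t)
  where
  instance
    ε-positive = positive 0<ε
    ε-nonZero = ℚP.pos⇒nonZero ε
    ε-nonNegative = ℚP.pos⇒nonNeg ε
  T = (ε + ∣ c ∣) * 1/ ε
  0≤T : 0ℚ ≤ T
  0≤T = *-mono-≤-nonneg ℚP.≤-refl (ℚP.+-mono-≤ (ℚP.<⇒≤ 0<ε) (ℚP.0≤∣p∣ c))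
                        ℚP.≤-refl (ℚP.<⇒≤ (ℚP.positive⁻¹ (1/ ε) {{ℚP.1/pos⇒pos ε}}))
  Tε≡ε+∣c∣ : T * ε ≡ ε + ∣ c ∣
  Tε≡ε+∣c∣ = trans (ℚP.*-assoc (ε + ∣ c ∣) (1/ ε) ε)
                   (trans (cong ((ε + ∣ c ∣) *_) (ℚP.*-inverseˡ ε)) (ℚP.*-identityʳ _))
  shift : ∀ ε a → ε ≡ - a + (ε + a)
  shift = solve-∀ ℚ-ring
  open ℚP.≤-Reasoning
  bound : ∀ t → N < t → T < t → ε ≤ c + t * f t
  bound t N<t T<t = begin
    ε                     ≡⟨ shift ε ∣ c ∣ ⟩
    - ∣ c ∣ + (ε + ∣ c ∣) ≡⟨ cong (λ x → - ∣ c ∣ + x) Tε≡ε+∣c∣ ⟨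
    - ∣ c ∣ + T * ε       ≤⟨ ℚP.+-monoʳ-≤ (- ∣ c ∣) (ℚP.*-monoʳ-≤-nonNeg ε (ℚP.<⇒≤ T<t)) ⟩
    - ∣ c ∣ + t * ε       ≤⟨ ℚP.+-mono-≤ (-∣p∣≤p c)
                               (ℚP.*-monoˡ-≤-nonNeg t {{nonNegative (ℚP.<⇒≤ (ℚP.≤-<-trans 0≤T T<t))}} (ε≤f t N<t)) ⟩
    c + t * f t           ∎

Trichotomy : (ℚ → ℚ) → Set
Trichotomy f = (∀ t → f t ≡ 0ℚ) ⊎ EventuallyPositive f ⊎ EventuallyPositive (λ t → - f t)

constant-trichotomy : ∀ {f} c → (∀ t → f t ≡ c) → Trichotomy f
constant-trichotomy c f≡c with ℚP.<-cmp c 0ℚ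
... | tri< c<0 _ _ = inj₂ (inj₂ (- c , ℚP.neg-antimono-< c<0 ,
                                 eventually-always (λ t → ℚP.≤-reflexive (cong -_ (sym (f≡c t))))))
... | tri≈ _ c≡0 _ = inj₁ (λ t → trans (f≡c t) c≡0)
... | tri> _ _ 0<c = inj₂ (inj₁ (c , 0<c , eventually-always (λ t → ℚP.≤-reflexive (sym (f≡c t)))))

polynomial-trichotomy : ∀ p → Trichotomy (evalQ p)
polynomial-trichotomy []      = inj₁ (λ _ → refl)
polynomial-trichotomy (c ∷ p) with polynomial-trichotomy p
... | inj₁ p≡0 = constant-trichotomy c (λ t → trans (cong (λ x → c + t * x) (p≡0 t)) (absorb c t))
  where
  absorb : ∀ c t → c + t * 0ℚ ≡ c
  absorb = solve-∀ ℚ-ring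
... | inj₂ (inj₁ p-pos) = inj₂ (inj₁ (EventuallyPositive-horner c p-pos))
... | inj₂ (inj₂ p-neg) = inj₂ (inj₂ (EventuallyPositive-cong (λ t → negate c t (evalQ p t))
                                                              (EventuallyPositive-horner (- c) p-neg)))
  where
  negate : ∀ c t x → - c + t * (- x) ≡ - (c + t * x)
  negate = solve-∀ ℚ-ring

IsRational : (ℚ → ℚ) → Set
IsRational f = ∃[ P ] ∃[ Q ] EventuallyPositive (evalQ Q) × Eventually (λ t → f t * evalQ Q t ≡ evalQ P t)

IsRational-cong : ∀ {f h} → Eventually (λ t → f t ≡ h t) → IsRational f → IsRational h
IsRational-cong f≡h (P , Q , Q-pos , fQ≡P) = P , Q , Q-pos ,
  eventually-map (λ t (f≡h , fQ≡P) → trans (cong (λ x → x * evalQ Q t) (sym f≡h)) fQ≡P) (eventually-zip f≡h fQ≡P)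

one-positive : EventuallyPositive (evalQ [ 1ℚ ])
one-positive = 1ℚ , ℚP.positive⁻¹ 1ℚ , eventually-always (λ t → ℚP.≤-reflexive (sym (absorb t)))
  where
  absorb : ∀ t → 1ℚ + t * 0ℚ ≡ 1ℚ
  absorb = solve-∀ ℚ-ring

IsRational-const : ∀ c → IsRational (λ _ → c)
IsRational-const c = [ c ] , [ 1ℚ ] , one-positive , eventually-always (identity c)
  where
  identity : ∀ c t → c * (1ℚ + t * 0ℚ) ≡ c + t * 0ℚ
  identity = solve-∀ ℚ-ring

IsRational-id : IsRational (λ t → t)
IsRational-id = 0ℚ ∷ [ 1ℚ ] , [ 1ℚ ] , one-positive , eventually-always identity
  where
  identity : ∀ t → t * (1ℚ + t * 0ℚ) ≡ 0ℚ + t * (1ℚ + t * 0ℚ)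
  identity = solve-∀ ℚ-ring

IsRational-+ : ∀ {f h} → IsRational f → IsRational h → IsRational (λ t → f t + h t)
IsRational-+ {f} {h} (P , Q , Q-pos , fQ≡P) (R , S , S-pos , hS≡R) =
  addQ (mulQ P S) (mulQ R Q) , mulQ Q S ,
  EventuallyPositive-cong (λ t → sym (evalQ-mulQ Q S t)) (EventuallyPositive-* Q-pos S-pos) ,
  eventually-map sum (eventually-zip fQ≡P hS≡R)
  where
  cross : ∀ a b q s → (a + b) * (q * s) ≡ (a * q) * s + (b * s) * q
  cross = solve-∀ ℚ-ring
  sum : ∀ t → (f t * evalQ Q t ≡ evalQ P t) × (h t * evalQ S t ≡ evalQ R t) →
        (f t + h t) * evalQ (mulQ Q S) t ≡ evalQ (addQ (mulQ P S) (mulQ R Q)) t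
  sum t (fQ≡P , hS≡R) = begin
    (f t + h t) * evalQ (mulQ Q S) t                          ≡⟨ cong ((f t + h t) *_) (evalQ-mulQ Q S t) ⟩
    (f t + h t) * (evalQ Q t * evalQ S t)                     ≡⟨ cross (f t) (h t) (evalQ Q t) (evalQ S t) ⟩
    (f t * evalQ Q t) * evalQ S t + (h t * evalQ S t) * evalQ Q t ≡⟨ cong₂ (λ x y → x * evalQ S t + y * evalQ Q t) fQ≡P hS≡R ⟩
    evalQ P t * evalQ S t + evalQ R t * evalQ Q t             ≡⟨ cong₂ _+_ (evalQ-mulQ P S t) (evalQ-mulQ R Q t) ⟨
    evalQ (mulQ P S) t + evalQ (mulQ R Q) t                   ≡⟨ evalQ-addQ (mulQ P S) (mulQ R Q) t ⟨
    evalQ (addQ (mulQ P S) (mulQ R Q)) t                      ∎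
    where open ≡-Reasoning

IsRational-* : ∀ {f h} → IsRational f → IsRational h → IsRational (λ t → f t * h t)
IsRational-* {f} {h} (P , Q , Q-pos , fQ≡P) (R , S , S-pos , hS≡R) =
  mulQ P R , mulQ Q S ,
  EventuallyPositive-cong (λ t → sym (evalQ-mulQ Q S t)) (EventuallyPositive-* Q-pos S-pos) ,
  eventually-map product (eventually-zip fQ≡P hS≡R)
  where
  interchange : ∀ a b q s → (a * b) * (q * s) ≡ (a * q) * (b * s)
  interchange = solve-∀ ℚ-ring
  product : ∀ t → (f t * evalQ Q t ≡ evalQ P t) × (h t * evalQ S t ≡ evalQ R t) →
            (f t * h t) * evalQ (mulQ Q S) t ≡ evalQ (mulQ P R) t
  product t (fQ≡P , hS≡R) = begin
    (f t * h t) * evalQ (mulQ Q S) t                  ≡⟨ cong ((f t * h t) *_) (evalQ-mulQ Q S t) ⟩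
    (f t * h t) * (evalQ Q t * evalQ S t)             ≡⟨ interchange (f t) (h t) (evalQ Q t) (evalQ S t) ⟩
    (f t * evalQ Q t) * (h t * evalQ S t)             ≡⟨ cong₂ _*_ fQ≡P hS≡R ⟩
    evalQ P t * evalQ R t                             ≡⟨ evalQ-mulQ P R t ⟨
    evalQ (mulQ P R) t                                ∎
    where open ≡-Reasoning

recip-cancel : ∀ x y → x * y ≢ 0ℚ → divℚ 1ℚ x * (x * y) ≡ y
recip-cancel x y xy≢0 = begin
  divℚ 1ℚ x * (x * y)   ≡⟨ ℚP.*-assoc (divℚ 1ℚ x) x y ⟨
  divℚ 1ℚ x * x * y     ≡⟨ cong (_* y) (divℚ-*-cancel 1ℚ x x≢0) ⟩
  1ℚ * y                ≡⟨ ℚP.*-identityˡ y ⟩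
  y                     ∎
  where
  open ≡-Reasoning
  x≢0 : x ≢ 0ℚ
  x≢0 x≡0 = xy≢0 (trans (cong (_* y) x≡0) (ℚP.*-zeroˡ y))

IsRational-recip : ∀ {f} → IsRational f → IsRational (λ t → divℚ 1ℚ (f t))
IsRational-recip {f} (P , Q , Q-pos , fQ≡P) with polynomial-trichotomy P
... | inj₁ P≡0 = IsRational-cong (eventually-map vanish (eventually-zip fQ≡P (EventuallyPositive⇒≢0 Q-pos)))
                                 (IsRational-const 0ℚ)
  where
  vanish : ∀ t → (f t * evalQ Q t ≡ evalQ P t) × (evalQ Q t ≢ 0ℚ) → 0ℚ ≡ divℚ 1ℚ (f t)
  vanish t (fQ≡P , Q≢0) =
    trans (sym (divℚ-by-0 1ℚ)) (cong (divℚ 1ℚ) (sym (*-cancelʳ-≡0 (f t) (evalQ Q t) Q≢0 (trans fQ≡P (P≡0 t)))))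
... | inj₂ (inj₁ P-pos) = Q , P , P-pos , eventually-map invert (eventually-zip fQ≡P (EventuallyPositive⇒≢0 P-pos))
  where
  invert : ∀ t → (f t * evalQ Q t ≡ evalQ P t) × (evalQ P t ≢ 0ℚ) → divℚ 1ℚ (f t) * evalQ P t ≡ evalQ Q t
  invert t (fQ≡P , P≢0) = subst (λ p → divℚ 1ℚ (f t) * p ≡ evalQ Q t) fQ≡P
                                (recip-cancel (f t) (evalQ Q t) (subst (_≢ 0ℚ) (sym fQ≡P) P≢0))
... | inj₂ (inj₂ P-neg) =
  scaleQ (- 1ℚ) Q , scaleQ (- 1ℚ) P ,
  EventuallyPositive-cong (λ t → trans (negate (evalQ P t)) (sym (evalQ-scaleQ (- 1ℚ) P t))) P-neg ,
  eventually-map invert (eventually-zip fQ≡P (EventuallyPositive⇒≢0 P-neg))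
  where
  negate : ∀ x → - x ≡ - 1ℚ * x
  negate = solve-∀ ℚ-ring
  swap : ∀ a x → a * (- 1ℚ * x) ≡ - 1ℚ * (a * x)
  swap = solve-∀ ℚ-ring
  invert : ∀ t → (f t * evalQ Q t ≡ evalQ P t) × (- evalQ P t ≢ 0ℚ) →
           divℚ 1ℚ (f t) * evalQ (scaleQ (- 1ℚ) P) t ≡ evalQ (scaleQ (- 1ℚ) Q) t
  invert t (fQ≡P , -P≢0) = begin
    divℚ 1ℚ (f t) * evalQ (scaleQ (- 1ℚ) P) t     ≡⟨ cong (divℚ 1ℚ (f t) *_) (evalQ-scaleQ (- 1ℚ) P t) ⟩
    divℚ 1ℚ (f t) * (- 1ℚ * evalQ P t)            ≡⟨ swap (divℚ 1ℚ (f t)) (evalQ P t) ⟩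
    - 1ℚ * (divℚ 1ℚ (f t) * evalQ P t)            ≡⟨ cong (λ p → - 1ℚ * (divℚ 1ℚ (f t) * p)) fQ≡P ⟨
    - 1ℚ * (divℚ 1ℚ (f t) * (f t * evalQ Q t))    ≡⟨ cong (- 1ℚ *_) (recip-cancel (f t) (evalQ Q t) fQ≢0) ⟩
    - 1ℚ * evalQ Q t                              ≡⟨ evalQ-scaleQ (- 1ℚ) Q t ⟨
    evalQ (scaleQ (- 1ℚ) Q) t                     ∎
    where
    open ≡-Reasoning
    fQ≢0 : f t * evalQ Q t ≢ 0ℚ
    fQ≢0 fQ≡0 = -P≢0 (cong -_ (trans (sym fQ≡P) fQ≡0))

divℚ-as-* : ∀ p q → divℚ p q ≡ p * divℚ 1ℚ q
divℚ-as-* p q with q ≟ 0ℚ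
... | yes _ = sym (ℚP.*-zeroʳ p)
... | no q≢0 = cong (p *_) (sym (ℚP.*-identityˡ _))

IsRational-divℚ : ∀ {f h} → IsRational f → IsRational h → IsRational (λ t → divℚ (f t) (h t))
IsRational-divℚ {f} {h} f-rat h-rat =
  IsRational-cong (eventually-always (λ t → sym (divℚ-as-* (f t) (h t))))
                  (IsRational-* {f} {λ t → divℚ 1ℚ (h t)} f-rat (IsRational-recip {h} h-rat))

IsRational-sub : ∀ {f h} → IsRational f → IsRational h → IsRational (λ t → f t - h t)
IsRational-sub {f} {h} f-rat h-rat =
  IsRational-cong (eventually-always (λ t → subtract (f t) (h t)))
                  (IsRational-+ {f} {λ t → - 1ℚ * h t} f-rat (IsRational-* {λ _ → - 1ℚ} {h} (IsRational-const (- 1ℚ)) h-rat))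
  where
  subtract : ∀ x y → x + - 1ℚ * y ≡ x - y
  subtract = solve-∀ ℚ-ring

IsRational-sign : ∀ {f} → IsRational f →
  Eventually (λ t → f t ≡ 0ℚ) ⊎ Eventually (λ t → 0ℚ < f t) ⊎ Eventually (λ t → f t < 0ℚ)
IsRational-sign {f} (P , Q , Q-pos , fQ≡P) with polynomial-trichotomy P
... | inj₁ P≡0 = inj₁ (eventually-map (λ t (fQ≡P , Q≢0) → *-cancelʳ-≡0 (f t) (evalQ Q t) Q≢0 (trans fQ≡P (P≡0 t)))
                                      (eventually-zip fQ≡P (EventuallyPositive⇒≢0 Q-pos)))
... | inj₂ (inj₁ P-pos) = inj₂ (inj₁ (eventually-map positive-factor
        (eventually-zip fQ≡P (eventually-zip (EventuallyPositive⇒>0 P-pos) (EventuallyPositive⇒>0 Q-pos)))))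
  where
  positive-factor : ∀ t → (f t * evalQ Q t ≡ evalQ P t) × (0ℚ < evalQ P t) × (0ℚ < evalQ Q t) → 0ℚ < f t
  positive-factor t (fQ≡P , 0<P , 0<Q) = ℚP.*-cancelʳ-<-nonNeg (evalQ Q t) {{nonNegative (ℚP.<⇒≤ 0<Q)}}
    (subst₂ _<_ (sym (ℚP.*-zeroˡ (evalQ Q t))) (sym fQ≡P) 0<P)
... | inj₂ (inj₂ P-neg) = inj₂ (inj₂ (eventually-map negative-factor
        (eventually-zip fQ≡P (eventually-zip (EventuallyPositive⇒>0 P-neg) (EventuallyPositive⇒>0 Q-pos)))))
  where
  negative-factor : ∀ t → (f t * evalQ Q t ≡ evalQ P t) × (0ℚ < - evalQ P t) × (0ℚ < evalQ Q t) → f t < 0ℚ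
  negative-factor t (fQ≡P , 0<-P , 0<Q) = ℚP.*-cancelʳ-<-nonNeg (evalQ Q t) {{nonNegative (ℚP.<⇒≤ 0<Q)}}
    (subst₂ _<_ (sym fQ≡P) (sym (ℚP.*-zeroˡ (evalQ Q t)))
      (subst (_< 0ℚ) (neg-involutive (evalQ P t)) (ℚP.neg-antimono-< 0<-P)))

IsRational-sign-≢0 : ∀ {f} → IsRational f → Eventually (λ t → f t ≢ 0ℚ) →
  Eventually (λ t → 0ℚ < f t) ⊎ Eventually (λ t → f t < 0ℚ)
IsRational-sign-≢0 f-rat f≢0 with IsRational-sign f-rat
... | inj₁ f≡0 = ⊥-elim (let (t , ft≡0 , ft≢0) = eventually-witness (eventually-zip f≡0 f≢0) in ft≢0 ft≡0)
... | inj₂ sign = sign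

RationalVec : ∀ {m} → (ℚ → QVec m) → Set
RationalVec F = ∀ r → IsRational (λ t → F t r)

IsRational-dot : ∀ {m} {F G : ℚ → QVec m} → RationalVec F → RationalVec G → IsRational (λ t → dot (F t) (G t))
IsRational-dot {zero}          _     _     = IsRational-const 0ℚ
IsRational-dot {suc m} {F} {G} F-rat G-rat =
  IsRational-+ {λ t → F t Fin.zero * G t Fin.zero} {λ t → dot (F t ∘ Fin.suc) (G t ∘ Fin.suc)}
    (IsRational-* {λ t → F t Fin.zero} {λ t → G t Fin.zero} (F-rat Fin.zero) (G-rat Fin.zero))
    (IsRational-dot {m} {λ t → F t ∘ Fin.suc} {λ t → G t ∘ Fin.suc} (F-rat ∘ Fin.suc) (G-rat ∘ Fin.suc))

RationalVec-project : ∀ {m} {F U : ℚ → QVec m} → RationalVec F → RationalVec U → RationalVec (λ t → project (F t) (U t))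
RationalVec-project {F = F} {U} F-rat U-rat r =
  IsRational-sub {λ t → F t r} {λ t → divℚ (dot (F t) (U t)) (dot (U t) (U t)) * U t r} (F-rat r)
    (IsRational-* {λ t → divℚ (dot (F t) (U t)) (dot (U t) (U t))} {λ t → U t r}
      (IsRational-divℚ {λ t → dot (F t) (U t)} {λ t → dot (U t) (U t)}
        (IsRational-dot {F = F} {U} F-rat U-rat) (IsRational-dot {F = U} {U} U-rat U-rat))
      (U-rat r))

RationalVec-reduce : ∀ {m} (Us : List (ℚ → QVec m)) {F : ℚ → QVec m} → All RationalVec Us → RationalVec F →
                     RationalVec (λ t → reduce (F t) (List.map (λ U → U t) Us))
RationalVec-reduce []       _                F-rat = F-rat
RationalVec-reduce (U ∷ Us) {F} (U-rat ∷ Us-rat) F-rat =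
  RationalVec-reduce Us {λ t → project (F t) (U t)} Us-rat (RationalVec-project {F = F} {U} F-rat U-rat)

-- The Gram–Schmidt vectors of v t as functions of t, so that rationality can be proved along the list.

module _ {m} (v : ℚ → ℕ → QVec m) where

  starFns : ℕ → List (ℚ → QVec m)
  starFns zero    = []
  starFns (suc x) = starFns x ++ [ (λ t → reduce (v t x) (List.map (λ U → U t) (starFns x))) ]

  stars-starFns : ∀ t x → starsUpTo (v t) x ≡ List.map (λ U → U t) (starFns x)
  stars-starFns t zero    = refl
  stars-starFns t (suc x) =
    trans (cong (λ us → us ++ [ reduce (v t x) us ]) (stars-starFns t x))
          (sym (ListP.map-++ (λ U → U t) (starFns x) _))

  module _ (v-rat : ∀ x → RationalVec (λ t → v t x)) where

    starFns-rational : ∀ x → All RationalVec (starFns x)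
    starFns-rational zero    = []
    starFns-rational (suc x) =
      AllP.++⁺ (starFns-rational x) (RationalVec-reduce (starFns x) (starFns-rational x) (v-rat x) ∷ [])

    RationalVec-star : ∀ x → RationalVec (λ t → GramSchmidt.star (v t) x)
    RationalVec-star x r =
      IsRational-cong (eventually-always (λ t → cong (λ us → reduce (v t x) us r) (sym (stars-starFns t x))))
                      (RationalVec-reduce (starFns x) (starFns-rational x) (v-rat x) r)

IsRational-evalPoly : ∀ p → IsRational (evalPoly p)
IsRational-evalPoly []       = IsRational-const 0ℚ
IsRational-evalPoly (c ∷ cs) =
  IsRational-+ {λ _ → c / 1} {λ t → t * evalPoly cs t} (IsRational-const (c / 1))
    (IsRational-* {λ t → t} {evalPoly cs} IsRational-id (IsRational-evalPoly cs))

RationalVec-ext : ∀ {m n} (W : ℚ → Fin n → QVec m) → (∀ i → RationalVec (λ t → W t i)) →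
                  ∀ x → RationalVec (λ t → ext (W t) x)
RationalVec-ext {n = n} W W-rat x with x ℕ.<? n
... | yes x<n = W-rat (fromℕ< x<n)
... | no _    = λ _ → IsRational-const 0ℚ

IsRational-rho : ∀ {m n} (g : Fin n → PVec m) i ℓ → IsRational (rho g i ℓ)
IsRational-rho g i ℓ =
  IsRational-divℚ {λ t → dot (evalVec (g i) t) (gsStar g ℓ t)} {gsNormSq g ℓ}
    (IsRational-dot {F = λ t → evalVec (g i) t} {λ t → gsStar g ℓ t} (IsRational-evalPoly ∘ g i) star-rat)
    (IsRational-dot {F = λ t → gsStar g ℓ t} {λ t → gsStar g ℓ t} star-rat star-rat)
  where
  star-rat : RationalVec (λ t → gsStar g ℓ t)
  star-rat = RationalVec-star (λ t → ext (λ i → evalVec (g i) t))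
               (RationalVec-ext (λ t i → evalVec (g i) t) (λ i r → IsRational-evalPoly (g i r))) (toℕ ℓ)

-- Polynomial families and the shear g k ↦ g k + c · g j

replaceAt-same : ∀ {m n} (g : Fin n → PVec m) k w → replaceAt g k w k ≡ w
replaceAt-same g k w with k Fin.≟ k
... | yes _   = refl
... | no k≢k = ⊥-elim (k≢k refl)

replaceAt-other : ∀ {m n} (g : Fin n → PVec m) k w {i} → i ≢ k → replaceAt g k w i ≡ g i
replaceAt-other g k w {i} i≢k with i Fin.≟ k
... | yes i≡k = ⊥-elim (i≢k i≡k)
... | no _    = refl

ext-toℕ : ∀ {m n} (v : Fin n → QVec m) i → ext v (toℕ i) ≡ v i
ext-toℕ {n = n} v i with toℕ i ℕ.<? n
... | yes i<n = cong v (FinP.fromℕ<-toℕ i i<n)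
... | no i≮n  = ⊥-elim (i≮n (FinP.toℕ<n i))

evalFamily : ∀ {m n} → (Fin n → PVec m) → ℚ → ℕ → QVec m
evalFamily g t = ext (λ i → evalVec (g i) t)

/1-+ : ∀ a b → (a ℤ.+ b) / 1 ≡ a / 1 + b / 1
/1-+ a b = ℚP.toℚᵘ-injective (begin
  toℚᵘ ((a ℤ.+ b) / 1)                ≈⟨ ℚP.toℚᵘ-fromℚᵘ (ℚᵘ.mkℚᵘ (a ℤ.+ b) 0) ⟩
  ℚᵘ.mkℚᵘ (a ℤ.+ b) 0                 ≈⟨ ℚᵘ.*≡* (distrib a b) ⟩
  ℚᵘ.mkℚᵘ a 0 ℚᵘ.+ ℚᵘ.mkℚᵘ b 0        ≈⟨ ℚᵘP.+-cong (ℚP.toℚᵘ-fromℚᵘ (ℚᵘ.mkℚᵘ a 0)) (ℚP.toℚᵘ-fromℚᵘ (ℚᵘ.mkℚᵘ b 0)) ⟨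
  toℚᵘ (a / 1) ℚᵘ.+ toℚᵘ (b / 1)      ≈⟨ ℚP.toℚᵘ-homo-+ (a / 1) (b / 1) ⟨
  toℚᵘ (a / 1 + b / 1)                ∎)
  where
  open ℚᵘP.≃-Reasoning
  distrib : ∀ a b → (a ℤ.+ b) ℤ.* ℤ.1ℤ ≡ (a ℤ.* ℤ.1ℤ ℤ.+ b ℤ.* ℤ.1ℤ) ℤ.* ℤ.1ℤ
  distrib = ℤ-Solver.solve-∀

/1-neg : ∀ a → (ℤ.- a) / 1 ≡ - (a / 1)
/1-neg a = ℚP.toℚᵘ-injective (begin
  toℚᵘ ((ℤ.- a) / 1)        ≈⟨ ℚP.toℚᵘ-fromℚᵘ (ℚᵘ.mkℚᵘ (ℤ.- a) 0) ⟩
  ℚᵘ.- ℚᵘ.mkℚᵘ a 0          ≈⟨ ℚᵘP.-‿cong (ℚP.toℚᵘ-fromℚᵘ (ℚᵘ.mkℚᵘ a 0)) ⟨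
  ℚᵘ.- toℚᵘ (a / 1)         ≈⟨ ℚP.toℚᵘ-homo‿- (a / 1) ⟨
  toℚᵘ (- (a / 1))          ∎)
  where open ℚᵘP.≃-Reasoning

evalPoly-polyAdd : ∀ p q t → evalPoly (polyAdd p q) t ≡ evalPoly p t + evalPoly q t
evalPoly-polyAdd []      q       t = sym (ℚP.+-identityˡ (evalPoly q t))
evalPoly-polyAdd (a ∷ p) []      t = sym (ℚP.+-identityʳ (evalPoly (a ∷ p) t))
evalPoly-polyAdd (a ∷ p) (b ∷ q) t =
  trans (cong₂ (λ x y → x + t * y) (/1-+ a b) (evalPoly-polyAdd p q t)) (regroup (a / 1) (b / 1) t _ _)
  where
  regroup : ∀ a b t x y → (a + b) + t * (x + y) ≡ (a + t * x) + (b + t * y)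
  regroup = solve-∀ ℚ-ring

evalPoly-polyNeg : ∀ q t → evalPoly (polyNeg q) t ≡ - evalPoly q t
evalPoly-polyNeg []      t = refl
evalPoly-polyNeg (b ∷ q) t =
  trans (cong₂ (λ x y → x + t * y) (/1-neg b) (evalPoly-polyNeg q t)) (negate (b / 1) t _)
  where
  negate : ∀ b t x → - b + t * (- x) ≡ - (b + t * x)
  negate = solve-∀ ℚ-ring

signℚ : Bool → ℚ
signℚ true  = 1ℚ
signℚ false = - 1ℚ

evalVec-sheared : ∀ {m} s (a b : PVec m) t →
  evalVec (if s then vecAdd a b else vecSub a b) t ≈ᵛ axpy (evalVec a t) (signℚ s) (evalVec b t)
evalVec-sheared true  a b t r = trans (evalPoly-polyAdd (a r) (b r) t) (cong (λ x → evalPoly (a r) t + x) (sym (ℚP.*-identityˡ _)))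
evalVec-sheared false a b t r =
  trans (evalPoly-polyAdd (a r) (polyNeg (b r)) t)
        (trans (cong (λ x → evalPoly (a r) t + x) (evalPoly-polyNeg (b r) t)) (negate (evalPoly (a r) t) (evalPoly (b r) t)))
  where
  negate : ∀ x y → x + - y ≡ x + - 1ℚ * y
  negate = solve-∀ ℚ-ring

module _ {m n} (g : Fin n → PVec m) where

  private
    module G t = GramSchmidt (evalFamily g t)

  evalVec≈evalFamily : ∀ i t → evalVec (g i) t ≈ᵛ evalFamily g t (toℕ i)
  evalVec≈evalFamily i t r = cong (λ v → v r) (sym (ext-toℕ (λ i → evalVec (g i) t) i))

  rho-above-diagonal : ∀ {j i} → j Fin.< i → ∀ t → rho g j i t ≡ 0ℚ
  rho-above-diagonal {j} {i} j<i t = begin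
    divℚ (dot (evalVec (g j) t) (gsStar g i t)) (gsNormSq g i t)
      ≡⟨ cong (λ x → divℚ x (gsNormSq g i t)) (dot-cong (evalVec≈evalFamily j t) (λ _ → refl)) ⟩
    divℚ (dot (evalFamily g t (toℕ j)) (gsStar g i t)) (gsNormSq g i t)
      ≡⟨ cong (λ x → divℚ x (gsNormSq g i t)) (dot≡0 (G.v-⊥-later-star t j<i)) ⟩
    divℚ 0ℚ (gsNormSq g i t)
      ≡⟨ divℚ-0 (gsNormSq g i t) ⟩
    0ℚ ∎
    where open ≡-Reasoning

  rho-diagonal : ∀ j t → gsNormSq g j t ≢ 0ℚ → rho g j j t ≡ 1ℚ
  rho-diagonal j t N≢0 = begin
    divℚ (dot (evalVec (g j) t) (gsStar g j t)) (gsNormSq g j t)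
      ≡⟨ cong (λ x → divℚ x (gsNormSq g j t)) (dot-cong (evalVec≈evalFamily j t) (λ _ → refl)) ⟩
    divℚ (dot (evalFamily g t (toℕ j)) (gsStar g j t)) (gsNormSq g j t)
      ≡⟨ cong (λ x → divℚ x (gsNormSq g j t)) (G.dot-v-star t (toℕ j)) ⟩
    divℚ (gsNormSq g j t) (gsNormSq g j t)
      ≡⟨ divℚ-self (gsNormSq g j t) N≢0 ⟩
    1ℚ ∎
    where open ≡-Reasoning

module Shear {m n} (g : Fin n → PVec m) {j k : Fin n} (j<k : j Fin.< k) (c : ℚ) (w : PVec m)
             (w≈ : ∀ t → evalVec w t ≈ᵛ axpy (evalVec (g k) t) c (evalVec (g j) t)) where

  g′ : Fin n → PVec m
  g′ = replaceAt g k w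

  evalFamily-other : ∀ t x → x ≢ toℕ k → evalFamily g′ t x ≈ᵛ evalFamily g t x
  evalFamily-other t x x≢k r with x ℕ.<? n
  ... | yes x<n = cong (λ v → evalVec v t r)
                       (replaceAt-other g k w (λ x≡k → x≢k (trans (sym (FinP.toℕ-fromℕ< x<n)) (cong toℕ x≡k))))
  ... | no _    = refl

  evalFamily-k : ∀ t → evalFamily g′ t (toℕ k) ≈ᵛ axpy (evalFamily g t (toℕ k)) c (evalFamily g t (toℕ j))
  evalFamily-k t r = begin
    evalFamily g′ t (toℕ k) r                           ≡⟨ cong (λ v → v r) (ext-toℕ (λ i → evalVec (g′ i) t) k) ⟩
    evalVec (g′ k) t r                                  ≡⟨ cong (λ v → evalVec v t r) (replaceAt-same g k w) ⟩
    evalVec w t r                                       ≡⟨ w≈ t r ⟩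
    evalVec (g k) t r + c * evalVec (g j) t r           ≡⟨ cong₂ (λ x y → x + c * y) (evalVec≈evalFamily g k t r)
                                                                                    (evalVec≈evalFamily g j t r) ⟩
    evalFamily g t (toℕ k) r + c * evalFamily g t (toℕ j) r ∎
    where open ≡-Reasoning

  gsStar-shear : ∀ i t → gsStar g′ i t ≈ᵛ gsStar g i t
  gsStar-shear i t = star-shear j<k c (evalFamily-other t) (evalFamily-k t) (toℕ i)

  gsNormSq-shear : ∀ i t → gsNormSq g′ i t ≡ gsNormSq g i t
  gsNormSq-shear i t = dot-cong (gsStar-shear i t) (gsStar-shear i t)

  rho-shear-other : ∀ {ℓ} i → ℓ ≢ k → ∀ t → rho g′ ℓ i t ≡ rho g ℓ i t
  rho-shear-other i ℓ≢k t =
    cong₂ divℚ (dot-cong (λ r → cong (λ v → evalVec v t r) (replaceAt-other g k w ℓ≢k)) (gsStar-shear i t))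
               (gsNormSq-shear i t)

  rho-shear-k : ∀ i t → rho g′ k i t ≡ rho g k i t + c * rho g j i t
  rho-shear-k i t = begin
    divℚ (dot (evalVec (g′ k) t) (gsStar g′ i t)) (gsNormSq g′ i t)
      ≡⟨ cong₂ divℚ (dot-cong (λ r → trans (cong (λ v → evalVec v t r) (replaceAt-same g k w)) (w≈ t r))
                              (gsStar-shear i t))
                    (gsNormSq-shear i t) ⟩
    divℚ (dot (axpy (evalVec (g k) t) c (evalVec (g j) t)) (gsStar g i t)) (gsNormSq g i t)
      ≡⟨ cong (λ x → divℚ x (gsNormSq g i t)) (dot-axpyˡ (evalVec (g k) t) c (evalVec (g j) t) (gsStar g i t)) ⟩
    divℚ (dot (evalVec (g k) t) (gsStar g i t) + c * dot (evalVec (g j) t) (gsStar g i t)) (gsNormSq g i t)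
      ≡⟨ divℚ-axpy _ c _ (gsNormSq g i t) ⟩
    rho g k i t + c * rho g j i t ∎
    where open ≡-Reasoning

  rho-shear-k-after : ∀ {i} → j Fin.< i → ∀ t → rho g′ k i t ≡ rho g k i t
  rho-shear-k-after {i} j<i t = begin
    rho g′ k i t                    ≡⟨ rho-shear-k i t ⟩
    rho g k i t + c * rho g j i t   ≡⟨ cong (λ x → rho g k i t + c * x) (rho-above-diagonal g j<i t) ⟩
    rho g k i t + c * 0ℚ            ≡⟨ drop (rho g k i t) c ⟩
    rho g k i t                     ∎
    where
    open ≡-Reasoning
    drop : ∀ x c → x + c * 0ℚ ≡ x
    drop = solve-∀ ℚ-ring

  rho-shear-kj : ∀ t → gsNormSq g j t ≢ 0ℚ → rho g′ k j t ≡ rho g k j t + c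
  rho-shear-kj t N≢0 = begin
    rho g′ k j t                    ≡⟨ rho-shear-k j t ⟩
    rho g k j t + c * rho g j j t   ≡⟨ cong (λ x → rho g k j t + c * x) (rho-diagonal g j t N≢0) ⟩
    rho g k j t + c * 1ℚ            ≡⟨ cong (λ x → rho g k j t + x) (ℚP.*-identityʳ c) ⟩
    rho g k j t + c                 ∎
    where open ≡-Reasoning

-- Limits and the size reduction

Close : (ℚ → ℚ) → (ℚ → ℚ) → Set
Close F G = ∀ ε → 0ℚ < ε → Eventually (λ t → ∣ G t - F t ∣ < ε)

Close-≡ : ∀ {F G} → (∀ t → G t ≡ F t) → Close F G
Close-≡ {F} G≡F ε 0<ε = eventually-always λ t →
  subst (_< ε) (sym (trans (cong (λ x → ∣ x - F t ∣) (G≡F t)) (cong ∣_∣ (ℚP.+-inverseʳ (F t))))) 0<ε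

0<ε*½ : ∀ {ε} → 0ℚ < ε → 0ℚ < ε * ½
0<ε*½ {ε} 0<ε = ℚP.positive⁻¹ _ {{ℚP.pos*pos⇒pos ε {{positive 0<ε}} ½}}

LimitGE-close : ∀ {F G δ} → LimitGE F δ → Close F G → LimitGE G δ
LimitGE-close {F} {G} (inj₁ (L , F→L , δ≤L)) F≈G = inj₁ (L , G→L , δ≤L)
  where
  halves : ∀ ε → ε * ½ + ε * ½ ≡ ε
  halves = solve-∀ ℚ-ring
  telescope : ∀ x y l → x - l ≡ (x - y) + (y - l)
  telescope = solve-∀ ℚ-ring
  G→L : HasLimit G L
  G→L ε 0<ε = eventually-map triangle (eventually-zip (F→L (ε * ½) (0<ε*½ 0<ε)) (F≈G (ε * ½) (0<ε*½ 0<ε)))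
    where
    open ℚP.≤-Reasoning
    triangle : ∀ t → (∣ F t - L ∣ < ε * ½) × (∣ G t - F t ∣ < ε * ½) → ∣ G t - L ∣ < ε
    triangle t (∣F-L∣<ε/2 , ∣G-F∣<ε/2) = begin-strict
      ∣ G t - L ∣                  ≡⟨ cong ∣_∣ (telescope (G t) (F t) L) ⟩
      ∣ (G t - F t) + (F t - L) ∣  ≤⟨ ℚP.∣p+q∣≤∣p∣+∣q∣ (G t - F t) (F t - L) ⟩
      ∣ G t - F t ∣ + ∣ F t - L ∣  <⟨ ℚP.+-mono-< ∣G-F∣<ε/2 ∣F-L∣<ε/2 ⟩
      ε * ½ + ε * ½                ≡⟨ halves ε ⟩
      ε                            ∎
LimitGE-close {F} {G} (inj₂ F→∞) F≈G =
  inj₂ λ M → eventually-map (above M) (eventually-zip (F→∞ (M + 1ℚ)) (F≈G 1ℚ (ℚP.positive⁻¹ 1ℚ)))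
  where
  open ℚP.≤-Reasoning
  shift : ∀ m → m ≡ (m + 1ℚ) + - 1ℚ
  shift = solve-∀ ℚ-ring
  cancel : ∀ x y → y + (x - y) ≡ x
  cancel = solve-∀ ℚ-ring
  above : ∀ M t → (M + 1ℚ < F t) × (∣ G t - F t ∣ < 1ℚ) → M < G t
  above M t (M+1<F , ∣G-F∣<1) = begin-strict
    M                       ≡⟨ shift M ⟩
    (M + 1ℚ) + - 1ℚ         <⟨ ℚP.+-mono-< M+1<F (proj₁ (∣p∣<q⇒-q<p<q ∣G-F∣<1)) ⟩
    F t + (G t - F t)       ≡⟨ cancel (G t) (F t) ⟩
    G t                     ∎

shift-by-sign : ∀ s x → x + signℚ s ≡ signℚ s * (1ℚ + signℚ s * x)
shift-by-sign true  = solve-∀ ℚ-ring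
shift-by-sign false = solve-∀ ℚ-ring

sq-shift-by-sign : ∀ s x → sq (x + signℚ s) ≡ sq x + ((1ℚ + 1ℚ) * (signℚ s * x) + 1ℚ)
sq-shift-by-sign true  = expand
  where
  expand : ∀ x → (x + 1ℚ) * (x + 1ℚ) ≡ x * x + ((1ℚ + 1ℚ) * (1ℚ * x) + 1ℚ)
  expand = solve-∀ ℚ-ring
sq-shift-by-sign false = expand
  where
  expand : ∀ x → (x + - 1ℚ) * (x + - 1ℚ) ≡ x * x + ((1ℚ + 1ℚ) * (- 1ℚ * x) + 1ℚ)
  expand = solve-∀ ℚ-ring

½<∣x∣⇒x≢0 : ∀ {x} → ½ < ∣ x ∣ → x ≢ 0ℚ
½<∣x∣⇒x≢0 ½<∣x∣ x≡0 = ℚP.<-asym (ℚP.positive⁻¹ ½) (subst (λ x → ½ < ∣ x ∣) x≡0 ½<∣x∣)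

∣signℚ∣ : ∀ s → ∣ signℚ s ∣ ≡ 1ℚ
∣signℚ∣ true  = refl
∣signℚ∣ false = refl

signℚ-false-opposes-pos : ∀ {x} → 0ℚ < x → signℚ false * x ≡ - ∣ x ∣
signℚ-false-opposes-pos {x} 0<x = trans (negate x) (cong -_ (sym (ℚP.0≤p⇒∣p∣≡p (ℚP.<⇒≤ 0<x))))
  where
  negate : ∀ x → - 1ℚ * x ≡ - x
  negate = solve-∀ ℚ-ring

signℚ-true-opposes-neg : ∀ {x} → x < 0ℚ → signℚ true * x ≡ - ∣ x ∣
signℚ-true-opposes-neg {x} x<0 = begin
  1ℚ * x         ≡⟨ ℚP.*-identityˡ x ⟩
  x              ≡⟨ neg-involutive x ⟨
  - (- x)        ≡⟨ cong -_ (ℚP.0≤p⇒∣p∣≡p (ℚP.<⇒≤ (ℚP.neg-antimono-< x<0))) ⟨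
  - ∣ - x ∣      ≡⟨ cong -_ (ℚP.∣-p∣≡∣p∣ x) ⟩
  - ∣ x ∣        ∎
  where open ≡-Reasoning

shift-against-sign : ∀ s x → signℚ s * x ≡ - ∣ x ∣ → ∣ x + signℚ s ∣ ≡ ∣ 1ℚ - ∣ x ∣ ∣
shift-against-sign s x sx≡-∣x∣ = begin
  ∣ x + signℚ s ∣                          ≡⟨ cong ∣_∣ (shift-by-sign s x) ⟩
  ∣ signℚ s * (1ℚ + signℚ s * x) ∣         ≡⟨ ℚP.∣p*q∣≡∣p∣*∣q∣ (signℚ s) _ ⟩
  ∣ signℚ s ∣ * ∣ 1ℚ + signℚ s * x ∣       ≡⟨ cong₂ (λ a b → a * ∣ 1ℚ + b ∣) (∣signℚ∣ s) sx≡-∣x∣ ⟩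
  1ℚ * ∣ 1ℚ - ∣ x ∣ ∣                      ≡⟨ ℚP.*-identityˡ _ ⟩
  ∣ 1ℚ - ∣ x ∣ ∣                           ∎
  where open ≡-Reasoning

∣1-a∣<½ : ∀ {a} → ½ < a → a - ½ < 1ℚ → ∣ 1ℚ - a ∣ < ½
∣1-a∣<½ {a} ½<a a-½<1 = -q<p<q⇒∣p∣<q lower upper
  where
  open ℚP.≤-Reasoning
  -½≡-1+½ : - ½ ≡ - 1ℚ + ½
  -½≡-1+½ = solve-∀ ℚ-ring
  reflect : ∀ a → - (a - ½) + ½ ≡ 1ℚ - a
  reflect = solve-∀ ℚ-ring
  1-½≡½ : 1ℚ - ½ ≡ ½
  1-½≡½ = solve-∀ ℚ-ring
  lower : - ½ < 1ℚ - a
  lower = begin-strict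
    - ½               ≡⟨ -½≡-1+½ ⟩
    - 1ℚ + ½          <⟨ ℚP.+-monoˡ-< ½ (ℚP.neg-antimono-< a-½<1) ⟩
    - (a - ½) + ½     ≡⟨ reflect a ⟩
    1ℚ - a            ∎
  upper : 1ℚ - a < ½
  upper = begin-strict
    1ℚ - a            <⟨ ℚP.+-monoʳ-< 1ℚ (ℚP.neg-antimono-< ½<a) ⟩
    1ℚ - ½            ≡⟨ 1-½≡½ ⟩
    ½                 ∎

lovászQuantity : ∀ {m n} → (Fin n → PVec m) → Fin n → Fin n → ℚ → ℚ
lovászQuantity h a b t = divℚ (gsNormSq h b t) (gsNormSq h a t) + sq (rho h b a t)

module SizeReduction {m n} (δ : ℚ) (g : Fin n → PVec m) {j k : Fin n} (j<k : j Fin.< k) (s : Bool)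
  (lovász : AsymLovasz δ g)
  (∣ρ∣→½ : HasLimit (λ t → ∣ rho g k j t ∣) ½)
  (½<∣ρ∣ : Eventually (λ t → ½ < ∣ rho g k j t ∣))
  (sρ≡-∣ρ∣ : Eventually (λ t → signℚ s * rho g k j t ≡ - ∣ rho g k j t ∣)) where

  open Shear g j<k (signℚ s) (if s then vecAdd (g k) (g j) else vecSub (g k) (g j)) (evalVec-sheared s (g k) (g j))

  ρ : ℚ → ℚ
  ρ = rho g k j

  Good : ℚ → Set
  Good t = (½ < ∣ ρ t ∣) × (∣ ρ t ∣ - ½ < 1ℚ) × (signℚ s * ρ t ≡ - ∣ ρ t ∣)

  eventually-good : Eventually Good
  eventually-good = eventually-map (λ t (½<∣ρ∣ , ∣∣ρ∣-½∣<1 , sρ≡-∣ρ∣) → ½<∣ρ∣ , proj₂ (∣p∣<q⇒-q<p<q ∣∣ρ∣-½∣<1) , sρ≡-∣ρ∣)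
    (eventually-zip ½<∣ρ∣ (eventually-zip (∣ρ∣→½ 1ℚ (ℚP.positive⁻¹ 1ℚ)) sρ≡-∣ρ∣))

  rho′-kj : ∀ t → ½ < ∣ ρ t ∣ → rho g′ k j t ≡ ρ t + signℚ s
  rho′-kj t ½<∣ρ∣ = rho-shear-kj t N≢0
    where
    N≢0 : gsNormSq g j t ≢ 0ℚ
    N≢0 N≡0 = ½<∣x∣⇒x≢0 ½<∣ρ∣ (trans (cong (divℚ d) N≡0) (divℚ-by-0 d))
      where d = dot (evalVec (g k) t) (gsStar g j t)

  size-reduced : Eventually (λ t → ∣ rho g′ k j t ∣ < ½)
  size-reduced = eventually-map reduced eventually-good
    where
    reduced : ∀ t → Good t → ∣ rho g′ k j t ∣ < ½
    reduced t (½<∣ρ∣ , ∣ρ∣-½<1 , sρ≡-∣ρ∣) =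
      subst (_< ½) (sym (trans (cong ∣_∣ (rho′-kj t ½<∣ρ∣)) (shift-against-sign s (ρ t) sρ≡-∣ρ∣)))
            (∣1-a∣<½ ½<∣ρ∣ ∣ρ∣-½<1)

  -- The Lovász quantity for (j, k) moves by 1 - 2∣ρ∣, which tends to 0.
  lovász-jk-close : Close (lovászQuantity g j k) (lovászQuantity g′ j k)
  lovász-jk-close ε 0<ε = eventually-map close (eventually-zip eventually-good (∣ρ∣→½ (ε * ½) (0<ε*½ 0<ε)))
    where
    difference : ∀ A x y → (A + y) - (A + x) ≡ y - x
    difference = solve-∀ ℚ-ring
    linear : ∀ a x → (x + ((1ℚ + 1ℚ) * (- a) + 1ℚ)) - x ≡ (a - ½) * - (1ℚ + 1ℚ)
    linear = solve-∀ ℚ-ring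
    twice-half : ∀ ε → ε * ½ * (1ℚ + 1ℚ) ≡ ε
    twice-half = solve-∀ ℚ-ring
    close : ∀ t → Good t × (∣ ∣ ρ t ∣ - ½ ∣ < ε * ½) → ∣ lovászQuantity g′ j k t - lovászQuantity g j k t ∣ < ε
    close t ((½<∣ρ∣ , _ , sρ≡-∣ρ∣) , ∣∣ρ∣-½∣<ε/2) = begin-strict
      ∣ lovászQuantity g′ j k t - lovászQuantity g j k t ∣
        ≡⟨ cong (λ x → ∣ x - lovászQuantity g j k t ∣)
                (cong₂ (λ A y → A + sq y) (cong₂ divℚ (gsNormSq-shear k t) (gsNormSq-shear j t)) (rho′-kj t ½<∣ρ∣)) ⟩
      ∣ (A + sq (ρ t + signℚ s)) - (A + sq (ρ t)) ∣
        ≡⟨ cong ∣_∣ (difference A (sq (ρ t)) (sq (ρ t + signℚ s))) ⟩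
      ∣ sq (ρ t + signℚ s) - sq (ρ t) ∣
        ≡⟨ cong (λ x → ∣ x - sq (ρ t) ∣)
                (trans (sq-shift-by-sign s (ρ t)) (cong (λ y → sq (ρ t) + ((1ℚ + 1ℚ) * y + 1ℚ)) sρ≡-∣ρ∣)) ⟩
      ∣ (sq (ρ t) + ((1ℚ + 1ℚ) * (- ∣ ρ t ∣) + 1ℚ)) - sq (ρ t) ∣
        ≡⟨ cong ∣_∣ (linear ∣ ρ t ∣ (sq (ρ t))) ⟩
      ∣ (∣ ρ t ∣ - ½) * - (1ℚ + 1ℚ) ∣
        ≡⟨ ℚP.∣p*q∣≡∣p∣*∣q∣ (∣ ρ t ∣ - ½) (- (1ℚ + 1ℚ)) ⟩
      ∣ ∣ ρ t ∣ - ½ ∣ * (1ℚ + 1ℚ)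
        <⟨ ℚP.*-monoˡ-<-pos (1ℚ + 1ℚ) ∣∣ρ∣-½∣<ε/2 ⟩
      ε * ½ * (1ℚ + 1ℚ)
        ≡⟨ twice-half ε ⟩
      ε ∎
      where
      open ℚP.≤-Reasoning
      A = divℚ (gsNormSq g k t) (gsNormSq g j t)

  lovász-pair : ∀ a b → toℕ b ≡ suc (toℕ a) → Dec (b ≡ k) → Dec (a ≡ j) → LimitGE (lovászQuantity g′ a b) δ
  lovász-pair a b b≡1+a (no b≢k) _ = LimitGE-close (lovász a b b≡1+a) (Close-≡ λ t →
    cong₂ (λ x y → x + sq y) (cong₂ divℚ (gsNormSq-shear b t) (gsNormSq-shear a t)) (rho-shear-other a b≢k t))
  lovász-pair j k b≡1+a (yes refl) (yes refl) = LimitGE-close (lovász j k b≡1+a) lovász-jk-close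
  lovász-pair a k b≡1+a (yes refl) (no a≢j)   = LimitGE-close (lovász a k b≡1+a) (Close-≡ λ t →
    cong₂ (λ x y → x + sq y) (cong₂ divℚ (gsNormSq-shear k t) (gsNormSq-shear a t))
          (rho-shear-k-after j<a t))
    where
    j<a : j Fin.< a
    j<a = ℕP.≤∧≢⇒< (ℕP.≤-pred (subst (suc (toℕ j) ℕ.≤_) b≡1+a j<k)) (λ j≡a → a≢j (sym (FinP.toℕ-injective j≡a)))

  lovász′ : AsymLovasz δ g′
  lovász′ a b b≡1+a = lovász-pair a b b≡1+a (b Fin.≟ k) (a Fin.≟ j)

  conclusion : ((∀ i → j Fin.< i → i Fin.< k → EqRF (rho g′ k i) (rho g k i))
                × (∀ ℓ i → ℓ ≢ k → i Fin.< ℓ → EqRF (rho g′ ℓ i) (rho g ℓ i)))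
               × Eventually (λ t → ∣ rho g′ k j t ∣ < ½)
               × AsymLovasz δ g′
  conclusion =
    ( (λ i j<i _ → eventually-always (rho-shear-k-after j<i))
    , (λ ℓ i ℓ≢k _ → eventually-always (rho-shear-other i ℓ≢k)) )
    , size-reduced
    , lovász′

lemma3p12 : (m n d : ℕ) (δ : ℚ) → (+ 1 / 4) < δ → δ < (+ 1 / 1) →
    (g : Fin n → PVec m) →
    (∀ i → VecDeg (g i) d) →
    LinIndep g →
    AsymLLLReduced δ g →
    (j k : Fin n) → j Data.Fin.< k →
    HasLimit (λ t → ∣ rho g k j t ∣) ½ →
    Eventually (λ t → ½ < ∣ rho g k j t ∣) →
    ∃[ s ] (let g′ = replaceAt g k (if s then vecAdd (g k) (g j) else vecSub (g k) (g j)) in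
      ((∀ i → j Data.Fin.< i → i Data.Fin.< k → EqRF (rho g′ k i) (rho g k i))
       × (∀ ℓ i → ℓ ≢ k → i Data.Fin.< ℓ → EqRF (rho g′ ℓ i) (rho g ℓ i)))
      × Eventually (λ t → ∣ rho g′ k j t ∣ < ½)
      × AsymLovasz δ g′)
lemma3p12 m n d δ _ _ g _ _ (lovász , _) j k j<k ∣ρ∣→½ ½<∣ρ∣ =
  [ (λ 0<ρ → false , SizeReduction.conclusion δ g j<k false lovász ∣ρ∣→½ ½<∣ρ∣
                       (eventually-map (λ t → signℚ-false-opposes-pos) 0<ρ))
  , (λ ρ<0 → true , SizeReduction.conclusion δ g j<k true lovász ∣ρ∣→½ ½<∣ρ∣
                      (eventually-map (λ t → signℚ-true-opposes-neg) ρ<0))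
  ]′ (IsRational-sign-≢0 (IsRational-rho g k j) (eventually-map (λ t → ½<∣x∣⇒x≢0) ½<∣ρ∣))
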